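{- Let $G$ be an undirected connected loopless multigraph on vertex set $\{0,\dots,n\}$, $n\ge1$, with Laplacian lattice $L_G$. Then the packing radius of $L_G$ under the simplicial distance function $d_\triangle$ is $$\mathrm{Pac}_\triangle(L_G)=\frac{\mathrm{MC}_1(G)}{n+1}.$$
   Context: The Laplacian lattice $L_G\subset H_0=\{x\in\mathbb{R}^{n+1}:\sum_ix_i=0\}$ is the set of integer combinations of the rows of $Q(G)=D(G)-A(G)$ (degree matrix minus adjacency matrix with multiplicities). Let $\triangle\subset H_0$ be the convex hull of $t_0,\dots,t_n$, where $t_i$ has $i$-th coordinate $n$ and all others $-1$, and $\triangle(p,R)=p+R\triangle$. The packing radius is $\mathrm{Pac}_\triangle(L)=\sup\{R:\triangle(q_1,R)\cap\triangle(q_2,R)=\emptyset \text{ for all } q_1\ne q_2\in L\}$. For a nonempty proper subset $S\subset V(G)$, the weight $\mu_1(S)=\sum_{v\in S}\deg_{S,\bar S}(v)$, where $\deg_{S,\bar S}(v)$ is the number of edges (with multiplicity) joining $v$ to $\bar S=V(G)\setminus S$; $\mathrm{MC}_1(G)$ is the minimum of $\mu_1(S)$ over all nonempty proper $S$ (i.e. the size of a minimum edge cut).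
   Formalization: The radii R in the supremum defining $\mathrm{Pac}_\triangle$ are rational, and the points of the simplices $\triangle(p,R)$ have rational coordinates rather than real ones. -}

module Defs where

open import Data.Nat as ℕ using (ℕ; zero; suc)
open import Data.Integer as ℤ using (ℤ)
open import Data.Rational as ℚ using (ℚ; _/_)
open import Data.Fin using (Fin; zero; suc; _≟_)
open import Data.Bool using (Bool; true; false; if_then_else_)
open import Data.Product using (Σ; ∃; _×_)
open import Relation.Nullary using (¬_; yes; no)
open import Relation.Binary.PropositionalEquality using (_≡_)

sumℕ : ∀ {m} → (Fin m → ℕ) → ℕ
sumℕ {zero} f = 0
sumℕ {suc m} f = f zero ℕ.+ sumℕ (λ i → f (suc i))

sumℤ : ∀ {m} → (Fin m → ℤ) → ℤ
sumℤ {zero} f = ℤ.+ 0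
sumℤ {suc m} f = f zero ℤ.+ sumℤ (λ i → f (suc i))

sumℚ : ∀ {m} → (Fin m → ℚ) → ℚ
sumℚ {zero} f = ℚ.0ℚ
sumℚ {suc m} f = f zero ℚ.+ sumℚ (λ i → f (suc i))

-- A multigraph on vertex set {0,…,n} = Fin (suc n), given by its
-- adjacency matrix with multiplicities: A i j = number of edges between i and j.
Adj : ℕ → Set
Adj n = Fin (suc n) → Fin (suc n) → ℕ

Undirected : ∀ {n} → Adj n → Set
Undirected A = ∀ i j → A i j ≡ A j i

Loopless : ∀ {n} → Adj n → Set
Loopless A = ∀ i → A i i ≡ 0

data Reachable {n} (A : Adj n) : Fin (suc n) → Fin (suc n) → Set where
  here : ∀ {i} → Reachable A i i
  step : ∀ {i k j} → ¬ (A i k ≡ 0) → Reachable A k j → Reachable A i j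

Connected : ∀ {n} → Adj n → Set
Connected A = ∀ i j → Reachable A i j

deg : ∀ {n} → Adj n → Fin (suc n) → ℕ
deg A i = sumℕ (λ j → A i j)

Laplacian : ∀ {n} → Adj n → Fin (suc n) → Fin (suc n) → ℤ
Laplacian A i j with i ≟ j
... | yes _ = ℤ.+ deg A i ℤ.- ℤ.+ A i j
... | no  _ = ℤ.- (ℤ.+ A i j)

InLattice : ∀ {n} → Adj n → (Fin (suc n) → ℤ) → Set
InLattice {n} A x = Σ (Fin (suc n) → ℤ) λ c →
  ∀ j → x j ≡ sumℤ (λ i → c i ℤ.* Laplacian A i j)

tvert : ∀ n → Fin (suc n) → Fin (suc n) → ℚ
tvert n i j with i ≟ j
... | yes _ = ℤ.+ n / 1
... | no  _ = ℤ.- (ℤ.+ 1) / 1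

-- x ∈ △(p,R) = p + R·conv(t_0,…,t_n)
InSimplex : ∀ n → (p : Fin (suc n) → ℤ) → (R : ℚ) → (x : Fin (suc n) → ℚ) → Set
InSimplex n p R x = Σ (Fin (suc n) → ℚ) λ λc →
  (∀ i → ℚ.0ℚ ℚ.≤ λc i) × (sumℚ λc ≡ ℚ.1ℚ) ×
  (∀ j → x j ≡ (p j / 1) ℚ.+ R ℚ.* sumℚ (λ i → λc i ℚ.* tvert n i j))

PairwiseDisjoint : ∀ {n} → Adj n → ℚ → Set
PairwiseDisjoint {n} A R = ∀ q₁ q₂ → InLattice A q₁ → InLattice A q₂ →
  ¬ (∀ j → q₁ j ≡ q₂ j) →
  ¬ (∃ λ x → InSimplex n q₁ R x × InSimplex n q₂ R x)

-- r is the supremum of {R : translates pairwise disjoint} (R ranging over ℚ)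
IsPackingRadius : ∀ {n} → Adj n → ℚ → Set
IsPackingRadius A r =
  (∀ R → PairwiseDisjoint A R → R ℚ.≤ r) ×
  (∀ R → R ℚ.< r → ∃ λ R' → PairwiseDisjoint A R' × R ℚ.< R')

μ₁ : ∀ {n} → Adj n → (Fin (suc n) → Bool) → ℕ
μ₁ A S = sumℕ (λ v → if S v then sumℕ (λ w → if S w then 0 else A v w) else 0)

NonemptyProper : ∀ {n} → (Fin (suc n) → Bool) → Set
NonemptyProper S = (∃ λ v → S v ≡ true) × (∃ λ w → S w ≡ false)

IsMC₁ : ∀ {n} → Adj n → ℕ → Set
IsMC₁ A m = (∃ λ S → NonemptyProper S × μ₁ A S ≡ m) ×
            (∀ S → NonemptyProper S → m ℕ.≤ μ₁ A S)

module Submission where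

-- A point of △(q,R) is x = q + R((n+1)β − 1) for barycentric weights β ≥ 0, Σβ = 1. If
-- △(q₁,R) and △(q₂,R) share a point, then q₂ − q₁ = (n+1)R(β₁ − β₂), so the sum of q₂ − q₁
-- over any set of vertices is at most (n+1)R. Write q₂ − q₁ = c·Q(G) and let T be the set where
-- c is maximal: (c·Q)_v = Σ_w A_vw (c_v − c_w) is at least the number of edges leaving T at v, so
-- the sum over T is at least μ₁(T) ≥ MC₁(G) (T is proper because q₁ ≠ q₂ forces c nonconstant).
-- Hence the translates are disjoint when (n+1)R < MC₁(G). Conversely, for a minimum cut S,
-- 𝟙_S·Q(G) = a − b where a_v counts the edges leaving S at v ∈ S and b_v those entering S at
-- v ∉ S; both have total MC₁(G), so for R > MC₁(G)/(n+1) and δ = R − MC₁(G)/(n+1) the point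
-- a + δ − R lies in △(0,R) and in △(a − b,R).

open import Defs
open import Algebra.Bundles using (CommutativeMonoid)
open import Data.Bool using (Bool; true; false; if_then_else_)
open import Data.Empty using (⊥; ⊥-elim)
open import Data.Fin using (Fin; zero; suc; _≟_)
import Data.Fin.Properties as FP
open import Data.Integer as ℤ using (ℤ; +_)
import Data.Integer.Properties as ℤP
open import Data.Integer.Tactic.RingSolver using () renaming (solve-∀ to solveℤ)
open import Data.List using (allFin)
open import Data.List.Membership.Propositional.Properties using (∈-allFin)
import Data.List.Relation.Unary.All as All
open import Data.Maybe using (Maybe; just; nothing)
open import Data.Nat as ℕ using (ℕ; zero; suc; _≥_)
import Data.Nat.Properties as ℕP
open import Data.Product using (∃; _×_; _,_; proj₁; proj₂)
open import Data.Rational as ℚ using (ℚ; _/_; 0ℚ; 1ℚ)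
import Data.Rational.Properties as ℚP
open import Data.Rational.Unnormalised as ℚᵘ using (mkℚᵘ; *≡*; *≤*)
import Data.Rational.Unnormalised.Properties as ℚᵘP
open import Function using (_∘_)
open import Level using (0ℓ)
open import Relation.Binary.PropositionalEquality
open import Relation.Nullary using (¬_; Dec; yes; no; does)
open import Relation.Nullary.Decidable using (dec-true; dec-false)
open import Tactic.RingSolver using (solve-∀)
open import Tactic.RingSolver.Core.AlmostCommutativeRing
  using (AlmostCommutativeRing; fromCommutativeRing)
open import Algebra.Properties.CommutativeSemigroup ℕP.+-commutativeSemigroup
  using () renaming (interchange to +-interchangeℕ)
open import Algebra.Properties.CommutativeSemigroup ℤP.+-commutativeSemigroup
  using () renaming (interchange to +-interchangeℤ)
open import Algebra.Properties.CommutativeSemigroup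
  (CommutativeMonoid.commutativeSemigroup ℚP.+-0-commutativeMonoid)
  using () renaming (interchange to +-interchangeℚ)

-- Without a zero test, coefficients that cancel are not removed and normal forms are not unique.
ℚ-ring : AlmostCommutativeRing 0ℓ 0ℓ
ℚ-ring = fromCommutativeRing ℚP.+-*-commutativeRing isZero
  where
  isZero : ∀ x → Maybe (0ℚ ≡ x)
  isZero x with 0ℚ ℚP.≟ x
  ... | yes 0≡x = just 0≡x
  ... | no _ = nothing

sumℕ-cong : ∀ {m} {f g : Fin m → ℕ} → (∀ i → f i ≡ g i) → sumℕ f ≡ sumℕ g
sumℕ-cong {zero} f≗g = refl
sumℕ-cong {suc m} f≗g = cong₂ ℕ._+_ (f≗g zero) (sumℕ-cong (λ i → f≗g (suc i)))

sumℕ-zero : ∀ m → sumℕ {m} (λ _ → 0) ≡ 0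
sumℕ-zero zero = refl
sumℕ-zero (suc m) = sumℕ-zero m

sumℕ-distrib-+ : ∀ {m} (f g : Fin m → ℕ) → sumℕ (λ i → f i ℕ.+ g i) ≡ sumℕ f ℕ.+ sumℕ g
sumℕ-distrib-+ {zero} f g = refl
sumℕ-distrib-+ {suc m} f g =
  trans (cong (ℕ._+_ (f zero ℕ.+ g zero)) (sumℕ-distrib-+ (λ i → f (suc i)) (λ i → g (suc i))))
        (+-interchangeℕ (f zero) (g zero) _ _)

sumℕ-comm : ∀ {m k} (f : Fin m → Fin k → ℕ) →
  sumℕ (λ i → sumℕ (λ j → f i j)) ≡ sumℕ (λ j → sumℕ (λ i → f i j))
sumℕ-comm {zero} {k} f = sym (sumℕ-zero k)
sumℕ-comm {suc m} f = trans (cong (ℕ._+_ (sumℕ (f zero))) (sumℕ-comm (λ i → f (suc i))))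
  (sym (sumℕ-distrib-+ (f zero) (λ j → sumℕ (λ i → f (suc i) j))))

term≤sumℕ : ∀ {m} (f : Fin m → ℕ) i → f i ℕ.≤ sumℕ f
term≤sumℕ f zero = ℕP.m≤m+n _ _
term≤sumℕ f (suc i) = ℕP.≤-trans (term≤sumℕ (λ i → f (suc i)) i) (ℕP.m≤n+m _ (f zero))

sumℕ-if-then : ∀ {m} b (f : Fin m → ℕ) →
  (if b then sumℕ f else 0) ≡ sumℕ (λ i → if b then f i else 0)
sumℕ-if-then true f = refl
sumℕ-if-then {m} false f = sym (sumℕ-zero m)

sumℕ-if-else : ∀ {m} b (f : Fin m → ℕ) →
  (if b then 0 else sumℕ f) ≡ sumℕ (λ i → if b then 0 else f i)
sumℕ-if-else {m} true f = sym (sumℕ-zero m)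
sumℕ-if-else false f = refl

sumℤ-cong : ∀ {m} {f g : Fin m → ℤ} → (∀ i → f i ≡ g i) → sumℤ f ≡ sumℤ g
sumℤ-cong {zero} f≗g = refl
sumℤ-cong {suc m} f≗g = cong₂ ℤ._+_ (f≗g zero) (sumℤ-cong (λ i → f≗g (suc i)))

sumℤ-zero : ∀ m → sumℤ {m} (λ _ → + 0) ≡ + 0
sumℤ-zero zero = refl
sumℤ-zero (suc m) = trans (ℤP.+-identityˡ _) (sumℤ-zero m)

sumℤ-distrib-+ : ∀ {m} (f g : Fin m → ℤ) → sumℤ (λ i → f i ℤ.+ g i) ≡ sumℤ f ℤ.+ sumℤ g
sumℤ-distrib-+ {zero} f g = refl
sumℤ-distrib-+ {suc m} f g =
  trans (cong (ℤ._+_ (f zero ℤ.+ g zero)) (sumℤ-distrib-+ (λ i → f (suc i)) (λ i → g (suc i))))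
        (+-interchangeℤ (f zero) (g zero) _ _)

neg-distrib-sumℤ : ∀ {m} (f : Fin m → ℤ) → ℤ.- sumℤ f ≡ sumℤ (λ i → ℤ.- f i)
neg-distrib-sumℤ {zero} f = refl
neg-distrib-sumℤ {suc m} f = trans (ℤP.neg-distrib-+ (f zero) _)
  (cong (ℤ._+_ (ℤ.- f zero)) (neg-distrib-sumℤ (λ i → f (suc i))))

sumℤ-distrib-- : ∀ {m} (f g : Fin m → ℤ) → sumℤ (λ i → f i ℤ.- g i) ≡ sumℤ f ℤ.- sumℤ g
sumℤ-distrib-- f g =
  trans (sumℤ-distrib-+ f (λ i → ℤ.- g i)) (cong (ℤ._+_ (sumℤ f)) (sym (neg-distrib-sumℤ g)))

*-distribˡ-sumℤ : ∀ {m} c (f : Fin m → ℤ) → c ℤ.* sumℤ f ≡ sumℤ (λ i → c ℤ.* f i)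
*-distribˡ-sumℤ {zero} c f = ℤP.*-zeroʳ c
*-distribˡ-sumℤ {suc m} c f = trans (ℤP.*-distribˡ-+ c (f zero) _)
  (cong (ℤ._+_ (c ℤ.* f zero)) (*-distribˡ-sumℤ c (λ i → f (suc i))))

+-sumℕ : ∀ {m} (f : Fin m → ℕ) → + sumℕ f ≡ sumℤ (λ i → + f i)
+-sumℕ {zero} f = refl
+-sumℕ {suc m} f = cong (ℤ._+_ (+ f zero)) (+-sumℕ (λ i → f (suc i)))

sumℤ-mono-≤ : ∀ {m} {f g : Fin m → ℤ} → (∀ i → f i ℤ.≤ g i) → sumℤ f ℤ.≤ sumℤ g
sumℤ-mono-≤ {zero} f≤g = ℤP.≤-refl
sumℤ-mono-≤ {suc m} f≤g = ℤP.+-mono-≤ (f≤g zero) (sumℤ-mono-≤ (λ i → f≤g (suc i)))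

sumℤ-single : ∀ {m} (f : Fin m → ℤ) j → (∀ i → i ≢ j → f i ≡ + 0) → sumℤ f ≡ f j
sumℤ-single {suc m} f zero f≡0 = trans
  (cong (ℤ._+_ (f zero)) (trans (sumℤ-cong (λ i → f≡0 (suc i) λ ())) (sumℤ-zero m)))
  (ℤP.+-identityʳ (f zero))
sumℤ-single {suc m} f (suc j) f≡0 = trans
  (cong (ℤ._+ sumℤ (λ i → f (suc i))) (f≡0 zero λ ())) (trans (ℤP.+-identityˡ _)
  (sumℤ-single (λ i → f (suc i)) j (λ i i≢j → f≡0 (suc i) (i≢j ∘ FP.suc-injective))))

sumℤ-over : ∀ {m} → (Fin m → Bool) → (Fin m → ℤ) → ℤ
sumℤ-over T f = sumℤ (λ j → if T j then f j else + 0)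

sumℚ-cong : ∀ {m} {f g : Fin m → ℚ} → (∀ i → f i ≡ g i) → sumℚ f ≡ sumℚ g
sumℚ-cong {zero} f≗g = refl
sumℚ-cong {suc m} f≗g = cong₂ ℚ._+_ (f≗g zero) (sumℚ-cong (λ i → f≗g (suc i)))

sumℚ-zero : ∀ m → sumℚ {m} (λ _ → 0ℚ) ≡ 0ℚ
sumℚ-zero zero = refl
sumℚ-zero (suc m) = trans (ℚP.+-identityˡ _) (sumℚ-zero m)

sumℚ-distrib-+ : ∀ {m} (f g : Fin m → ℚ) → sumℚ (λ i → f i ℚ.+ g i) ≡ sumℚ f ℚ.+ sumℚ g
sumℚ-distrib-+ {zero} f g = refl
sumℚ-distrib-+ {suc m} f g =
  trans (cong (ℚ._+_ (f zero ℚ.+ g zero)) (sumℚ-distrib-+ (λ i → f (suc i)) (λ i → g (suc i))))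
        (+-interchangeℚ (f zero) (g zero) _ _)

neg-distrib-sumℚ : ∀ {m} (f : Fin m → ℚ) → ℚ.- sumℚ f ≡ sumℚ (λ i → ℚ.- f i)
neg-distrib-sumℚ {zero} f = refl
neg-distrib-sumℚ {suc m} f = trans (ℚP.neg-distrib-+ (f zero) _)
  (cong (ℚ._+_ (ℚ.- f zero)) (neg-distrib-sumℚ (λ i → f (suc i))))

sumℚ-distrib-- : ∀ {m} (f g : Fin m → ℚ) → sumℚ (λ i → f i ℚ.- g i) ≡ sumℚ f ℚ.- sumℚ g
sumℚ-distrib-- f g =
  trans (sumℚ-distrib-+ f (λ i → ℚ.- g i)) (cong (ℚ._+_ (sumℚ f)) (sym (neg-distrib-sumℚ g)))

*-distribˡ-sumℚ : ∀ {m} c (f : Fin m → ℚ) → c ℚ.* sumℚ f ≡ sumℚ (λ i → c ℚ.* f i)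
*-distribˡ-sumℚ {zero} c f = ℚP.*-zeroʳ c
*-distribˡ-sumℚ {suc m} c f = trans (ℚP.*-distribˡ-+ c (f zero) _)
  (cong (ℚ._+_ (c ℚ.* f zero)) (*-distribˡ-sumℚ c (λ i → f (suc i))))

sumℚ-mono-≤ : ∀ {m} {f g : Fin m → ℚ} → (∀ i → f i ℚ.≤ g i) → sumℚ f ℚ.≤ sumℚ g
sumℚ-mono-≤ {zero} f≤g = ℚP.≤-refl
sumℚ-mono-≤ {suc m} f≤g = ℚP.+-mono-≤ (f≤g zero) (sumℚ-mono-≤ (λ i → f≤g (suc i)))

sumℚ-single : ∀ {m} (f : Fin m → ℚ) j → (∀ i → i ≢ j → f i ≡ 0ℚ) → sumℚ f ≡ f j
sumℚ-single {suc m} f zero f≡0 = trans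
  (cong (ℚ._+_ (f zero)) (trans (sumℚ-cong (λ i → f≡0 (suc i) λ ())) (sumℚ-zero m)))
  (ℚP.+-identityʳ (f zero))
sumℚ-single {suc m} f (suc j) f≡0 = trans
  (cong (ℚ._+ sumℚ (λ i → f (suc i))) (f≡0 zero λ ())) (trans (ℚP.+-identityˡ _)
  (sumℚ-single (λ i → f (suc i)) j (λ i i≢j → f≡0 (suc i) (i≢j ∘ FP.suc-injective))))

ι : ℤ → ℚ
ι z = z / 1

toℚᵘ-ι : ∀ z → ℚ.toℚᵘ (ι z) ℚᵘ.≃ mkℚᵘ z 0
toℚᵘ-ι z = ℚP.toℚᵘ-fromℚᵘ (mkℚᵘ z 0)

ι-+ : ∀ a b → ι (a ℤ.+ b) ≡ ι a ℚ.+ ι b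
ι-+ a b = ℚP.toℚᵘ-injective (begin
  ℚ.toℚᵘ (ι (a ℤ.+ b))              ≈⟨ toℚᵘ-ι (a ℤ.+ b) ⟩
  mkℚᵘ (a ℤ.+ b) 0                  ≈⟨ *≡* (cross-multiply a b) ⟩
  mkℚᵘ a 0 ℚᵘ.+ mkℚᵘ b 0            ≈⟨ ℚᵘP.+-cong (toℚᵘ-ι a) (toℚᵘ-ι b) ⟨
  ℚ.toℚᵘ (ι a) ℚᵘ.+ ℚ.toℚᵘ (ι b)    ≈⟨ ℚP.toℚᵘ-homo-+ (ι a) (ι b) ⟨
  ℚ.toℚᵘ (ι a ℚ.+ ι b)              ∎)
  where
  open ℚᵘP.≃-Reasoning
  cross-multiply : ∀ a b → (a ℤ.+ b) ℤ.* + 1 ≡ (a ℤ.* + 1 ℤ.+ b ℤ.* + 1) ℤ.* + 1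
  cross-multiply = solveℤ

ι-neg : ∀ a → ι (ℤ.- a) ≡ ℚ.- ι a
ι-neg a = ℚP.toℚᵘ-injective (begin
  ℚ.toℚᵘ (ι (ℤ.- a))     ≈⟨ toℚᵘ-ι (ℤ.- a) ⟩
  ℚᵘ.- mkℚᵘ a 0          ≈⟨ ℚᵘP.-‿cong (toℚᵘ-ι a) ⟨
  ℚᵘ.- ℚ.toℚᵘ (ι a)      ≈⟨ ℚP.toℚᵘ-homo‿- (ι a) ⟨
  ℚ.toℚᵘ (ℚ.- ι a)       ∎)
  where open ℚᵘP.≃-Reasoning

ι-- : ∀ a b → ι (a ℤ.- b) ≡ ι a ℚ.- ι b
ι-- a b = trans (ι-+ a (ℤ.- b)) (cong (ℚ._+_ (ι a)) (ι-neg b))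

ι-mono-≤ : ∀ {a b} → a ℤ.≤ b → ι a ℚ.≤ ι b
ι-mono-≤ {a} {b} a≤b = ℚP.toℚᵘ-cancel-≤
  (ℚᵘP.≤-respˡ-≃ (ℚᵘP.≃-sym (toℚᵘ-ι a)) (ℚᵘP.≤-respʳ-≃ (ℚᵘP.≃-sym (toℚᵘ-ι b))
    (*≤* (ℤP.*-monoʳ-≤-nonNeg (+ 1) a≤b))))

sumℚ-ι : ∀ {m} (f : Fin m → ℤ) → sumℚ (λ i → ι (f i)) ≡ ι (sumℤ f)
sumℚ-ι {zero} f = refl
sumℚ-ι {suc m} f =
  trans (cong (ℚ._+_ (ι (f zero))) (sumℚ-ι (λ i → f (suc i)))) (sym (ι-+ (f zero) _))

sumℚ-const : ∀ m c → sumℚ {m} (λ _ → c) ≡ ι (+ m) ℚ.* c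
sumℚ-const zero c = sym (ℚP.*-zeroˡ c)
sumℚ-const (suc m) c = begin
  c ℚ.+ sumℚ {m} (λ _ → c)        ≡⟨ cong (ℚ._+_ c) (sumℚ-const m c) ⟩
  c ℚ.+ ι (+ m) ℚ.* c             ≡⟨ collect c (ι (+ m)) ⟩
  (1ℚ ℚ.+ ι (+ m)) ℚ.* c          ≡⟨ cong (ℚ._* c) (ι-+ (+ 1) (+ m)) ⟨
  ι (+ suc m) ℚ.* c               ∎
  where
  open ≡-Reasoning
  collect : ∀ c k → c ℚ.+ k ℚ.* c ≡ (1ℚ ℚ.+ k) ℚ.* c
  collect = solve-∀ ℚ-ring

module Simplex (n : ℕ) where

  V : Set
  V = Fin (suc n)

  K : ℚ
  K = ι (+ suc n)

  instance
    K-positive : ℚ.Positive K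
    K-positive = ℚP.normalize-pos (suc n) 1

  K*[m/K]≡m : ∀ m → K ℚ.* (+ m / suc n) ≡ ι (+ m)
  K*[m/K]≡m m = ℚP.toℚᵘ-injective (begin
    ℚ.toℚᵘ (K ℚ.* (+ m / suc n))          ≈⟨ ℚP.toℚᵘ-homo-* K (+ m / suc n) ⟩
    ℚ.toℚᵘ K ℚᵘ.* ℚ.toℚᵘ (+ m / suc n)
      ≈⟨ ℚᵘP.*-cong (toℚᵘ-ι (+ suc n)) (ℚP.toℚᵘ-fromℚᵘ (mkℚᵘ (+ m) n)) ⟩
    mkℚᵘ (+ suc n) 0 ℚᵘ.* mkℚᵘ (+ m) n   ≈⟨ *≡* (cross-multiply (+ suc n) (+ m)) ⟩
    mkℚᵘ (+ m) 0                          ≈⟨ toℚᵘ-ι (+ m) ⟨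
    ℚ.toℚᵘ (ι (+ m))                      ∎)
    where
    open ℚᵘP.≃-Reasoning
    cross-multiply : ∀ k m → (k ℤ.* m) ℤ.* + 1 ≡ m ℤ.* (+ 1 ℤ.* k)
    cross-multiply = solveℤ

  tvert-diag : ∀ i → tvert n i i ≡ ι (+ n)
  tvert-diag i with i ≟ i
  ... | yes _ = refl
  ... | no i≢i = ⊥-elim (i≢i refl)

  tvert-offdiag : ∀ {i j} → i ≢ j → tvert n i j ≡ ℚ.- 1ℚ
  tvert-offdiag {i} {j} i≢j with i ≟ j
  ... | yes i≡j = ⊥-elim (i≢j i≡j)
  ... | no _ = refl

  tvert-combination : ∀ (β : V → ℚ) → sumℚ β ≡ 1ℚ → ∀ j →
    sumℚ (λ i → β i ℚ.* tvert n i j) ≡ K ℚ.* β j ℚ.- 1ℚ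
  tvert-combination β Σβ≡1 j = begin
    sumℚ (λ i → β i ℚ.* tvert n i j)     ≡⟨ sumℚ-cong (λ i → split (β i) (tvert n i j)) ⟩
    sumℚ (λ i → e i ℚ.- β i)             ≡⟨ sumℚ-distrib-- e β ⟩
    sumℚ e ℚ.- sumℚ β                    ≡⟨ cong₂ ℚ._-_ (sumℚ-single e j e≡0) Σβ≡1 ⟩
    β j ℚ.* tvert n j j ℚ.+ β j ℚ.- 1ℚ   ≡⟨ cong (λ t → β j ℚ.* t ℚ.+ β j ℚ.- 1ℚ) (tvert-diag j) ⟩
    β j ℚ.* ι (+ n) ℚ.+ β j ℚ.- 1ℚ       ≡⟨ collect (β j) (ι (+ n)) ⟩
    (1ℚ ℚ.+ ι (+ n)) ℚ.* β j ℚ.- 1ℚ     ≡⟨ cong (λ k → k ℚ.* β j ℚ.- 1ℚ) (ι-+ (+ 1) (+ n)) ⟨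
    K ℚ.* β j ℚ.- 1ℚ                     ∎
    where
    open ≡-Reasoning
    split : ∀ b t → b ℚ.* t ≡ (b ℚ.* t ℚ.+ b) ℚ.- b
    split = solve-∀ ℚ-ring
    collect : ∀ b k → b ℚ.* k ℚ.+ b ℚ.- 1ℚ ≡ (1ℚ ℚ.+ k) ℚ.* b ℚ.- 1ℚ
    collect = solve-∀ ℚ-ring
    cancel : ∀ b → b ℚ.* ℚ.- 1ℚ ℚ.+ b ≡ 0ℚ
    cancel = solve-∀ ℚ-ring
    e : V → ℚ
    e i = β i ℚ.* tvert n i j ℚ.+ β i
    e≡0 : ∀ i → i ≢ j → e i ≡ 0ℚ
    e≡0 i i≢j = trans (cong (λ t → β i ℚ.* t ℚ.+ β i) (tvert-offdiag i≢j)) (cancel (β i))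

  inSimplex-coordinates : ∀ (p : V → ℤ) R {x} (s : InSimplex n p R x) → ∀ j →
    x j ≡ ι (p j) ℚ.+ R ℚ.* (K ℚ.* proj₁ s j ℚ.- 1ℚ)
  inSimplex-coordinates p R (β , _ , Σβ≡1 , x≡) j =
    trans (x≡ j) (cong (λ t → ι (p j) ℚ.+ R ℚ.* t) (tvert-combination β Σβ≡1 j))

  overlap-bound : ∀ (q₁ q₂ : V → ℤ) {R x} → 0ℚ ℚ.≤ R →
    InSimplex n q₁ R x → InSimplex n q₂ R x → ∀ (T : V → Bool) →
    ι (sumℤ-over T (λ j → q₂ j ℤ.- q₁ j)) ℚ.≤ K ℚ.* R
  overlap-bound q₁ q₂ {R} R≥0 s₁@(β₁ , β₁≥0 , Σβ₁≡1 , _) s₂@(β₂ , β₂≥0 , _ , _) T = begin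
    ι (sumℤ-over T d)                           ≡⟨ sumℚ-ι (λ j → if T j then d j else + 0) ⟨
    sumℚ (λ j → ι (if T j then d j else + 0))   ≡⟨ sumℚ-cong restricted ⟩
    sumℚ (λ j → K ℚ.* R ℚ.* g j)                ≡⟨ *-distribˡ-sumℚ (K ℚ.* R) g ⟨
    K ℚ.* R ℚ.* sumℚ g                          ≤⟨ ℚP.*-monoˡ-≤-nonNeg (K ℚ.* R) (sumℚ-mono-≤ g≤β₁) ⟩
    K ℚ.* R ℚ.* sumℚ β₁                         ≡⟨ cong (ℚ._*_ (K ℚ.* R)) Σβ₁≡1 ⟩
    K ℚ.* R ℚ.* 1ℚ                              ≡⟨ ℚP.*-identityʳ (K ℚ.* R) ⟩
    K ℚ.* R                                     ∎
    where
    open ℚP.≤-Reasoning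
    instance
      KR-nonNeg : ℚ.NonNegative (K ℚ.* R)
      KR-nonNeg = ℚP.nonNeg*nonNeg⇒nonNeg K {{ℚP.pos⇒nonNeg K}} R {{ℚ.nonNegative R≥0}}
    d : V → ℤ
    d j = q₂ j ℤ.- q₁ j
    g : V → ℚ
    g j = if T j then β₁ j ℚ.- β₂ j else 0ℚ
    expand : ∀ a b R K u v → b ℚ.- a ≡
      (b ℚ.+ R ℚ.* (K ℚ.* v ℚ.- 1ℚ)) ℚ.- a ℚ.- R ℚ.* (K ℚ.* v ℚ.- 1ℚ)
    expand = solve-∀ ℚ-ring
    collect : ∀ a R K u v →
      (a ℚ.+ R ℚ.* (K ℚ.* u ℚ.- 1ℚ)) ℚ.- a ℚ.- R ℚ.* (K ℚ.* v ℚ.- 1ℚ) ≡ K ℚ.* R ℚ.* (u ℚ.- v)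
    collect = solve-∀ ℚ-ring
    difference : ∀ j → ι (d j) ≡ K ℚ.* R ℚ.* (β₁ j ℚ.- β₂ j)
    difference j = begin-equality
      ι (q₂ j ℤ.- q₁ j)                ≡⟨ ι-- (q₂ j) (q₁ j) ⟩
      ι (q₂ j) ℚ.- ι (q₁ j)            ≡⟨ expand (ι (q₁ j)) (ι (q₂ j)) R K (β₁ j) (β₂ j) ⟩
      (ι (q₂ j) ℚ.+ R ℚ.* (K ℚ.* β₂ j ℚ.- 1ℚ)) ℚ.- ι (q₁ j) ℚ.- R ℚ.* (K ℚ.* β₂ j ℚ.- 1ℚ)
        ≡⟨ cong (λ y → y ℚ.- ι (q₁ j) ℚ.- R ℚ.* (K ℚ.* β₂ j ℚ.- 1ℚ))
             (trans (sym (inSimplex-coordinates q₂ R s₂ j)) (inSimplex-coordinates q₁ R s₁ j)) ⟩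
      (ι (q₁ j) ℚ.+ R ℚ.* (K ℚ.* β₁ j ℚ.- 1ℚ)) ℚ.- ι (q₁ j) ℚ.- R ℚ.* (K ℚ.* β₂ j ℚ.- 1ℚ)
        ≡⟨ collect (ι (q₁ j)) R K (β₁ j) (β₂ j) ⟩
      K ℚ.* R ℚ.* (β₁ j ℚ.- β₂ j)      ∎
    restricted : ∀ j → ι (if T j then d j else + 0) ≡ K ℚ.* R ℚ.* g j
    restricted j with T j
    ... | true = difference j
    ... | false = sym (ℚP.*-zeroʳ (K ℚ.* R))
    g≤β₁ : ∀ j → g j ℚ.≤ β₁ j
    g≤β₁ j with T j
    ... | true = ℚP.≤-trans (ℚP.+-monoʳ-≤ (β₁ j) (ℚP.neg-antimono-≤ (β₂≥0 j)))
                           (ℚP.≤-reflexive (ℚP.+-identityʳ (β₁ j)))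
    ... | false = β₁≥0 j

  shift-inSimplex : ∀ (p : V → ℤ) (u : V → ℕ) {R δ : ℚ} {x : V → ℚ} →
    0ℚ ℚ.< R → 0ℚ ℚ.≤ δ → ι (+ sumℕ u) ℚ.+ K ℚ.* δ ≡ K ℚ.* R →
    (∀ j → x j ≡ ι (p j ℤ.+ + u j) ℚ.+ δ ℚ.- R) → InSimplex n p R x
  shift-inSimplex p u {R} {δ} {x} R>0 δ≥0 mass x≡ = β , β≥0 , Σβ≡1 , x≡combination
    where
    instance
      R-positive : ℚ.Positive R
      R-positive = ℚ.positive R>0
      KR-positive : ℚ.Positive (K ℚ.* R)
      KR-positive = ℚP.pos*pos⇒pos K R
      KR-nonZero : ℚ.NonZero (K ℚ.* R)
      KR-nonZero = ℚP.pos⇒nonZero (K ℚ.* R)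
      KR⁻¹-nonNeg : ℚ.NonNegative (ℚ.1/ (K ℚ.* R))
      KR⁻¹-nonNeg = ℚP.pos⇒nonNeg (ℚ.1/ (K ℚ.* R)) {{ℚP.1/pos⇒pos (K ℚ.* R)}}
    y : V → ℚ
    y j = ι (+ u j) ℚ.+ δ
    β : V → ℚ
    β j = ℚ.1/ (K ℚ.* R) ℚ.* y j
    β≥0 : ∀ j → 0ℚ ℚ.≤ β j
    β≥0 j = ℚP.nonNegative⁻¹ (β j) {{ℚP.nonNeg*nonNeg⇒nonNeg (ℚ.1/ (K ℚ.* R)) (y j)
      {{ℚ.nonNegative (ℚP.+-mono-≤ (ι-mono-≤ {+ 0} {+ u j} (ℤ.+≤+ ℕ.z≤n)) δ≥0)}}}}
    Σy≡KR : sumℚ y ≡ K ℚ.* R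
    Σy≡KR = begin
      sumℚ y                                  ≡⟨ sumℚ-distrib-+ (λ j → ι (+ u j)) (λ _ → δ) ⟩
      sumℚ (λ j → ι (+ u j)) ℚ.+ sumℚ {suc n} (λ _ → δ)
        ≡⟨ cong₂ ℚ._+_ (sumℚ-ι (λ j → + u j)) (sumℚ-const (suc n) δ) ⟩
      ι (sumℤ (λ j → + u j)) ℚ.+ K ℚ.* δ      ≡⟨ cong (λ s → ι s ℚ.+ K ℚ.* δ) (+-sumℕ u) ⟨
      ι (+ sumℕ u) ℚ.+ K ℚ.* δ                ≡⟨ mass ⟩
      K ℚ.* R                                 ∎
      where open ≡-Reasoning
    Σβ≡1 : sumℚ β ≡ 1ℚ
    Σβ≡1 = begin
      sumℚ β                                  ≡⟨ *-distribˡ-sumℚ (ℚ.1/ (K ℚ.* R)) y ⟨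
      ℚ.1/ (K ℚ.* R) ℚ.* sumℚ y               ≡⟨ cong (ℚ._*_ (ℚ.1/ (K ℚ.* R))) Σy≡KR ⟩
      ℚ.1/ (K ℚ.* R) ℚ.* (K ℚ.* R)            ≡⟨ ℚP.*-inverseˡ (K ℚ.* R) ⟩
      1ℚ                                      ∎
      where open ≡-Reasoning
    regroup : ∀ a b δ R → a ℚ.+ b ℚ.+ δ ℚ.- R ≡ a ℚ.+ (1ℚ ℚ.* (b ℚ.+ δ) ℚ.- R)
    regroup = solve-∀ ℚ-ring
    rescale : ∀ R K i y → R ℚ.* (K ℚ.* (i ℚ.* y) ℚ.- 1ℚ) ≡ i ℚ.* (K ℚ.* R) ℚ.* y ℚ.- R
    rescale = solve-∀ ℚ-ring
    x≡combination : ∀ j → x j ≡ ι (p j) ℚ.+ R ℚ.* sumℚ (λ i → β i ℚ.* tvert n i j)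
    x≡combination j = begin
      x j                                       ≡⟨ x≡ j ⟩
      ι (p j ℤ.+ + u j) ℚ.+ δ ℚ.- R             ≡⟨ cong (λ s → s ℚ.+ δ ℚ.- R) (ι-+ (p j) (+ u j)) ⟩
      ι (p j) ℚ.+ ι (+ u j) ℚ.+ δ ℚ.- R         ≡⟨ regroup (ι (p j)) (ι (+ u j)) δ R ⟩
      ι (p j) ℚ.+ (1ℚ ℚ.* y j ℚ.- R)
        ≡⟨ cong (λ c → ι (p j) ℚ.+ (c ℚ.* y j ℚ.- R)) (ℚP.*-inverseˡ (K ℚ.* R)) ⟨
      ι (p j) ℚ.+ (ℚ.1/ (K ℚ.* R) ℚ.* (K ℚ.* R) ℚ.* y j ℚ.- R)
        ≡⟨ cong (ℚ._+_ (ι (p j))) (rescale R K (ℚ.1/ (K ℚ.* R)) (y j)) ⟨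
      ι (p j) ℚ.+ R ℚ.* (K ℚ.* β j ℚ.- 1ℚ)
        ≡⟨ cong (λ t → ι (p j) ℚ.+ R ℚ.* t) (tvert-combination β Σβ≡1 j) ⟨
      ι (p j) ℚ.+ R ℚ.* sumℚ (λ i → β i ℚ.* tvert n i j)   ∎
      where open ≡-Reasoning

∃-argmax : ∀ {m} (f : Fin (suc m) → ℤ) → ∃ λ k → ∀ i → f i ℤ.≤ f k
∃-argmax {m} f = argmax f zero (allFin (suc m)) ,
  λ i → All.lookup (f[xs]≤f[argmax] {f = f} zero (allFin (suc m))) (∈-allFin i)
  where open import Data.List.Extrema ℤP.≤-totalOrder

levelSet : ∀ {m} → (Fin m → ℤ) → Fin m → Fin m → Bool
levelSet c k i = does (c i ℤP.≟ c k)

i<j⇒1≤j-i : ∀ {i j} → i ℤ.< j → + 1 ℤ.≤ j ℤ.- i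
i<j⇒1≤j-i {i} {j} i<j =
  subst (ℤ._≤ j ℤ.- i) (cancel i) (ℤP.+-monoˡ-≤ (ℤ.- i) (ℤP.i<j⇒suc[i]≤j i<j))
  where
  cancel : ∀ i → + 1 ℤ.+ i ℤ.- i ≡ + 1
  cancel = solveℤ

module Graph {n : ℕ} (A : Adj n) (A-sym : Undirected A) where

  V : Set
  V = Fin (suc n)

  latticePoint : (V → ℤ) → V → ℤ
  latticePoint c j = sumℤ (λ i → c i ℤ.* Laplacian A i j)

  Laplacian-diag : ∀ i → Laplacian A i i ≡ + deg A i ℤ.- + A i i
  Laplacian-diag i with i ≟ i
  ... | yes _ = refl
  ... | no i≢i = ⊥-elim (i≢i refl)

  Laplacian-offdiag : ∀ {i j} → i ≢ j → Laplacian A i j ≡ ℤ.- + A i j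
  Laplacian-offdiag {i} {j} i≢j with i ≟ j
  ... | yes i≡j = ⊥-elim (i≢j i≡j)
  ... | no _ = refl

  latticePoint-flow : ∀ c v → latticePoint c v ≡ sumℤ (λ w → + A v w ℤ.* (c v ℤ.- c w))
  latticePoint-flow c v = begin
    sumℤ (λ i → c i ℤ.* Laplacian A i v)
      ≡⟨ sumℤ-cong (λ i → split (c i) (Laplacian A i v) (+ A i v)) ⟩
    sumℤ (λ i → e i ℤ.- c i ℤ.* + A i v)
      ≡⟨ sumℤ-distrib-- e (λ i → c i ℤ.* + A i v) ⟩
    sumℤ e ℤ.- sumℤ (λ i → c i ℤ.* + A i v)
      ≡⟨ cong₂ ℤ._-_ (sumℤ-single e v e≡0) (sumℤ-cong (λ i → cong (λ a → c i ℤ.* + a) (A-sym i v))) ⟩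
    c v ℤ.* (Laplacian A v v ℤ.+ + A v v) ℤ.- sumℤ (λ w → c w ℤ.* + A v w)
      ≡⟨ cong (λ d → c v ℤ.* d ℤ.- sumℤ (λ w → c w ℤ.* + A v w)) diag+A≡deg ⟩
    c v ℤ.* sumℤ (λ w → + A v w) ℤ.- sumℤ (λ w → c w ℤ.* + A v w)
      ≡⟨ cong (ℤ._- sumℤ (λ w → c w ℤ.* + A v w)) (*-distribˡ-sumℤ (c v) (λ w → + A v w)) ⟩
    sumℤ (λ w → c v ℤ.* + A v w) ℤ.- sumℤ (λ w → c w ℤ.* + A v w)
      ≡⟨ sumℤ-distrib-- (λ w → c v ℤ.* + A v w) (λ w → c w ℤ.* + A v w) ⟨
    sumℤ (λ w → c v ℤ.* + A v w ℤ.- c w ℤ.* + A v w)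
      ≡⟨ sumℤ-cong (λ w → factor (c v) (c w) (+ A v w)) ⟩
    sumℤ (λ w → + A v w ℤ.* (c v ℤ.- c w))   ∎
    where
    open ≡-Reasoning
    split : ∀ c l a → c ℤ.* l ≡ c ℤ.* (l ℤ.+ a) ℤ.- c ℤ.* a
    split = solveℤ
    factor : ∀ x y a → x ℤ.* a ℤ.- y ℤ.* a ≡ a ℤ.* (x ℤ.- y)
    factor = solveℤ
    cancel : ∀ d a → d ℤ.- a ℤ.+ a ≡ d
    cancel = solveℤ
    e : V → ℤ
    e i = c i ℤ.* (Laplacian A i v ℤ.+ + A i v)
    e≡0 : ∀ i → i ≢ v → e i ≡ + 0
    e≡0 i i≢v = trans (cong (λ l → c i ℤ.* (l ℤ.+ + A i v)) (Laplacian-offdiag i≢v))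
      (trans (cong (ℤ._*_ (c i)) (ℤP.+-inverseˡ (+ A i v))) (ℤP.*-zeroʳ (c i)))
    diag+A≡deg : Laplacian A v v ℤ.+ + A v v ≡ sumℤ (λ w → + A v w)
    diag+A≡deg = trans (cong (ℤ._+ + A v v) (Laplacian-diag v))
      (trans (cancel (+ deg A v) (+ A v v)) (+-sumℕ (A v)))

  latticePoint-difference : ∀ c₁ c₂ j →
    latticePoint c₂ j ℤ.- latticePoint c₁ j ≡ latticePoint (λ i → c₂ i ℤ.- c₁ i) j
  latticePoint-difference c₁ c₂ j = trans
    (sym (sumℤ-distrib-- (λ i → c₂ i ℤ.* Laplacian A i j) (λ i → c₁ i ℤ.* Laplacian A i j)))
    (sumℤ-cong (λ i → factor (c₂ i) (c₁ i) (Laplacian A i j)))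
    where
    factor : ∀ x y l → x ℤ.* l ℤ.- y ℤ.* l ≡ (x ℤ.- y) ℤ.* l
    factor = solveℤ

  latticePoint-constant : ∀ c k → (∀ w → c w ≡ c k) → ∀ v → latticePoint c v ≡ + 0
  latticePoint-constant c k c≡ck v = trans (latticePoint-flow c v)
    (trans (sumℤ-cong (λ w → trans (cong (ℤ._*_ (+ A v w)) (cv-cw≡0 w)) (ℤP.*-zeroʳ (+ A v w))))
           (sumℤ-zero (suc n)))
    where
    cv-cw≡0 : ∀ w → c v ℤ.- c w ≡ + 0
    cv-cw≡0 w = trans (cong₂ ℤ._-_ (c≡ck v) (c≡ck w)) (ℤP.+-inverseʳ (c k))

  outDeg inDeg : (V → Bool) → V → ℕ
  outDeg S v = sumℕ (λ w → if S w then 0 else A v w)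
  inDeg S v = sumℕ (λ w → if S w then A v w else 0)

  indicator : (V → Bool) → V → ℤ
  indicator S i = if S i then + 1 else + 0

  latticePoint-indicator : ∀ S j → latticePoint (indicator S) j ≡
    + (if S j then outDeg S j else 0) ℤ.- + (if S j then 0 else inDeg S j)
  latticePoint-indicator S j = trans (latticePoint-flow (indicator S) j)
    (trans (sumℤ-cong (λ w → edge (A j w) (S j) (S w))) (edges (S j)))
    where
    edge : ∀ a s t → + a ℤ.* ((if s then + 1 else + 0) ℤ.- (if t then + 1 else + 0)) ≡
      (if s then + (if t then 0 else a) else ℤ.- + (if t then a else 0))
    edge a true true = ℤP.*-zeroʳ (+ a)
    edge a true false = ℤP.*-identityʳ (+ a)
    edge a false true = trans (ℤP.*-comm (+ a) (ℤ.- + 1)) (ℤP.-1*i≡-i (+ a))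
    edge a false false = ℤP.*-zeroʳ (+ a)
    edges : ∀ s →
      sumℤ (λ w → if s then + (if S w then 0 else A j w) else ℤ.- + (if S w then A j w else 0))
      ≡ + (if s then outDeg S j else 0) ℤ.- + (if s then 0 else inDeg S j)
    edges true = trans (sym (+-sumℕ (λ w → if S w then 0 else A j w))) (sym (ℤP.+-identityʳ _))
    edges false = trans (sym (neg-distrib-sumℤ (λ w → + (if S w then A j w else 0))))
      (trans (cong ℤ.-_ (sym (+-sumℕ (λ w → if S w then A j w else 0)))) (sym (ℤP.+-identityˡ _)))

  sum-inDeg≡μ₁ : ∀ S → sumℕ (λ j → if S j then 0 else inDeg S j) ≡ μ₁ A S
  sum-inDeg≡μ₁ S = begin
    sumℕ (λ j → if S j then 0 else inDeg S j)
      ≡⟨ sumℕ-cong (λ j → sumℕ-if-else (S j) (λ w → if S w then A j w else 0)) ⟩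
    sumℕ (λ j → sumℕ (λ w → if S j then 0 else (if S w then A j w else 0)))
      ≡⟨ sumℕ-cong (λ j → sumℕ-cong (λ w → crossing (S j) (S w) (A-sym j w))) ⟩
    sumℕ (λ j → sumℕ (λ w → if S w then (if S j then 0 else A w j) else 0))
      ≡⟨ sumℕ-comm (λ j w → if S w then (if S j then 0 else A w j) else 0) ⟩
    sumℕ (λ w → sumℕ (λ j → if S w then (if S j then 0 else A w j) else 0))
      ≡⟨ sumℕ-cong (λ w → sumℕ-if-then (S w) (λ j → if S j then 0 else A w j)) ⟨
    μ₁ A S   ∎
    where
    open ≡-Reasoning
    crossing : ∀ s t {x y : ℕ} → x ≡ y →
      (if s then 0 else (if t then x else 0)) ≡ (if t then (if s then 0 else y) else 0)
    crossing true true _ = refl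
    crossing true false _ = refl
    crossing false true x≡y = x≡y
    crossing false false _ = refl

  μ₁-positive : ∀ S {v w} → Reachable A v w → S v ≡ true → S w ≡ false → 1 ℕ.≤ μ₁ A S
  μ₁-positive S here Sv Sw with () ← trans (sym Sv) Sw
  μ₁-positive S {v} (step {k = k} Avk≢0 path) Sv Sw with S k in Sk
  ... | true = μ₁-positive S path Sk Sw
  ... | false = begin
    1                                 ≤⟨ ℕP.n≢0⇒n>0 Avk≢0 ⟩
    A v k                             ≡⟨ cong (λ b → if b then 0 else A v k) Sk ⟨
    (if S k then 0 else A v k)        ≤⟨ term≤sumℕ (λ w → if S w then 0 else A v w) k ⟩
    outDeg S v                        ≡⟨ cong (λ b → if b then outDeg S v else 0) Sv ⟨
    (if S v then outDeg S v else 0)   ≤⟨ term≤sumℕ (λ u → if S u then outDeg S u else 0) v ⟩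
    μ₁ A S                            ∎
    where open ℕP.≤-Reasoning

  latticePoint-indicator≢0 : ∀ S → 1 ℕ.≤ μ₁ A S → ¬ (∀ j → latticePoint (indicator S) j ≡ + 0)
  latticePoint-indicator≢0 S μ₁≥1 S·Q≡0 = ℕP.<⇒≢ μ₁≥1 (sym μ₁≡0)
    where
    out≡0 : ∀ s {x y} → + (if s then x else 0) ℤ.- + (if s then 0 else y) ≡ + 0 →
      (if s then x else 0) ≡ 0
    out≡0 true {x} x-0≡0 = ℤP.+-injective (trans (sym (ℤP.+-identityʳ (+ x))) x-0≡0)
    out≡0 false _ = refl
    μ₁≡0 : μ₁ A S ≡ 0
    μ₁≡0 = trans
      (sumℕ-cong (λ j → out≡0 (S j) (trans (sym (latticePoint-indicator S j)) (S·Q≡0 j))))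
      (sumℕ-zero (suc n))

  module _ (c : V → ℤ) (k : V) (c≤ck : ∀ i → c i ℤ.≤ c k) where

    outDeg-levelSet≤ : ∀ v → c v ≡ c k → + outDeg (levelSet c k) v ℤ.≤ latticePoint c v
    outDeg-levelSet≤ v cv≡ck = subst₂ ℤ._≤_
      (sym (+-sumℕ (λ w → if levelSet c k w then 0 else A v w))) (sym (latticePoint-flow c v))
      (sumℤ-mono-≤ edge)
      where
      cw≤cv : ∀ w → c w ℤ.≤ c v
      cw≤cv w = subst (c w ℤ.≤_) (sym cv≡ck) (c≤ck w)
      edge : ∀ w → + (if levelSet c k w then 0 else A v w) ℤ.≤ + A v w ℤ.* (c v ℤ.- c w)
      edge w with c w ℤP.≟ c k
      ... | yes _ = subst (ℤ._≤ + A v w ℤ.* (c v ℤ.- c w)) (ℤP.*-zeroʳ (+ A v w))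
        (ℤP.*-monoˡ-≤-nonNeg (+ A v w) (ℤP.i≤j⇒0≤j-i (cw≤cv w)))
      ... | no cw≢ck = subst (ℤ._≤ + A v w ℤ.* (c v ℤ.- c w)) (ℤP.*-identityʳ (+ A v w))
        (ℤP.*-monoˡ-≤-nonNeg (+ A v w)
          (i<j⇒1≤j-i (ℤP.≤∧≢⇒< (cw≤cv w) (λ cw≡cv → cw≢ck (trans cw≡cv cv≡ck)))))

    μ₁-levelSet≤ : + μ₁ A (levelSet c k) ℤ.≤ sumℤ-over (levelSet c k) (latticePoint c)
    μ₁-levelSet≤ = subst (ℤ._≤ sumℤ-over (levelSet c k) (latticePoint c))
      (sym (+-sumℕ (λ v → if levelSet c k v then outDeg (levelSet c k) v else 0)))
      (sumℤ-mono-≤ vertex)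
      where
      vertex : ∀ v → + (if levelSet c k v then outDeg (levelSet c k) v else 0) ℤ.≤
                     (if levelSet c k v then latticePoint c v else + 0)
      vertex v with c v ℤP.≟ c k
      ... | yes cv≡ck = outDeg-levelSet≤ v cv≡ck
      ... | no _ = ℤP.≤-refl

module Packing {n : ℕ} (A : Adj n) (A-sym : Undirected A) where
  open Simplex n
  open Graph A A-sym hiding (V)

  disjoint-below : ∀ {m} → (∀ S → NonemptyProper S → m ℕ.≤ μ₁ A S) →
    ∀ {R} → 0ℚ ℚ.≤ R → K ℚ.* R ℚ.< ι (+ m) → PairwiseDisjoint A R
  disjoint-below {m} m≤μ₁ {R} R≥0 KR<m q₁ q₂ (c₁ , q₁≡) (c₂ , q₂≡) q₁≢q₂ (_ , x∈△₁ , x∈△₂) =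
    cases (FP.all? (λ w → c w ℤP.≟ c k))
    where
    c : V → ℤ
    c i = c₂ i ℤ.- c₁ i
    k : V
    k = proj₁ (∃-argmax c)
    T : V → Bool
    T = levelSet c k
    q₂-q₁ : ∀ j → q₂ j ℤ.- q₁ j ≡ latticePoint c j
    q₂-q₁ j = trans (cong₂ ℤ._-_ (q₂≡ j) (q₁≡ j)) (latticePoint-difference c₁ c₂ j)
    cases : Dec (∀ w → c w ≡ c k) → ⊥
    cases (yes constant) = q₁≢q₂ (λ j → sym (ℤP.i-j≡0⇒i≡j (q₂ j) (q₁ j)
      (trans (q₂-q₁ j) (latticePoint-constant c k constant j))))
    cases (no nonconstant) with FP.¬∀⟶∃¬ (suc n) (λ w → c w ≡ c k) (λ w → c w ℤP.≟ c k) nonconstant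
    ... | w , cw≢ck = ℚP.<-irrefl refl (ℚP.≤-<-trans m≤KR KR<m)
      where
      T-proper : NonemptyProper T
      T-proper = (k , dec-true (c k ℤP.≟ c k) refl) , (w , dec-false (c w ℤP.≟ c k) cw≢ck)
      m≤KR : ι (+ m) ℚ.≤ K ℚ.* R
      m≤KR = begin
        ι (+ m)                                 ≤⟨ ι-mono-≤ (ℤ.+≤+ (m≤μ₁ T T-proper)) ⟩
        ι (+ μ₁ A T)                            ≤⟨ ι-mono-≤ (μ₁-levelSet≤ c k (proj₂ (∃-argmax c))) ⟩
        ι (sumℤ-over T (latticePoint c))
          ≡⟨ cong ι (sumℤ-cong (λ j → cong (λ z → if T j then z else + 0) (q₂-q₁ j))) ⟨
        ι (sumℤ-over T (λ j → q₂ j ℤ.- q₁ j))   ≤⟨ overlap-bound q₁ q₂ R≥0 x∈△₁ x∈△₂ T ⟩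
        K ℚ.* R                                 ∎
        where open ℚP.≤-Reasoning

  overlap-above : ∀ {m} S → μ₁ A S ≡ m → 1 ℕ.≤ m → ∀ {r R} → 0ℚ ℚ.≤ r → K ℚ.* r ≡ ι (+ m) →
    r ℚ.< R → ¬ PairwiseDisjoint A R
  overlap-above {m} S μ₁S≡m m≥1 {r} {R} r≥0 Kr≡m r<R disjoint =
    disjoint (λ _ → + 0) q 0∈L q∈L 0≢q
      (x , shift-inSimplex (λ _ → + 0) a R>0 δ≥0 (mass a μ₁S≡m) (λ j → refl)
         , shift-inSimplex q b R>0 δ≥0 (mass b (trans (sum-inDeg≡μ₁ S) μ₁S≡m)) x≡q+b)
    where
    q : V → ℤ
    q = latticePoint (indicator S)
    a b : V → ℕ
    a j = if S j then outDeg S j else 0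
    b j = if S j then 0 else inDeg S j
    δ : ℚ
    δ = R ℚ.- r
    x : V → ℚ
    x j = ι (+ a j) ℚ.+ δ ℚ.- R
    R>0 : 0ℚ ℚ.< R
    R>0 = ℚP.≤-<-trans r≥0 r<R
    δ≥0 : 0ℚ ℚ.≤ δ
    δ≥0 = subst (ℚ._≤ δ) (ℚP.+-inverseʳ r) (ℚP.+-monoˡ-≤ (ℚ.- r) (ℚP.<⇒≤ r<R))
    0∈L : InLattice A (λ _ → + 0)
    0∈L = (λ _ → + 0) , λ j →
      sym (trans (sumℤ-cong (λ i → ℤP.*-zeroˡ (Laplacian A i j))) (sumℤ-zero (suc n)))
    q∈L : InLattice A q
    q∈L = indicator S , λ j → refl
    0≢q : ¬ (∀ j → + 0 ≡ q j)
    0≢q 0≡q = latticePoint-indicator≢0 S (subst (1 ℕ.≤_) (sym μ₁S≡m) m≥1) (λ j → sym (0≡q j))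
    mass : ∀ u → sumℕ u ≡ m → ι (+ sumℕ u) ℚ.+ K ℚ.* δ ≡ K ℚ.* R
    mass u Σu≡m = begin
      ι (+ sumℕ u) ℚ.+ K ℚ.* δ       ≡⟨ cong (λ s → ι (+ s) ℚ.+ K ℚ.* δ) Σu≡m ⟩
      ι (+ m) ℚ.+ K ℚ.* δ            ≡⟨ cong (ℚ._+ K ℚ.* δ) Kr≡m ⟨
      K ℚ.* r ℚ.+ K ℚ.* (R ℚ.- r)    ≡⟨ telescope K r R ⟩
      K ℚ.* R                        ∎
      where
      open ≡-Reasoning
      telescope : ∀ K r R → K ℚ.* r ℚ.+ K ℚ.* (R ℚ.- r) ≡ K ℚ.* R
      telescope = solve-∀ ℚ-ring
    x≡q+b : ∀ j → x j ≡ ι (q j ℤ.+ + b j) ℚ.+ δ ℚ.- R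
    x≡q+b j = cong (λ z → ι z ℚ.+ δ ℚ.- R)
      (sym (trans (cong (ℤ._+ + b j) (latticePoint-indicator S j)) (cancel (+ a j) (+ b j))))
      where
      cancel : ∀ a b → a ℤ.- b ℤ.+ b ≡ a
      cancel = solveℤ

  isPackingRadius : ∀ {m r} → Connected A → IsMC₁ A m → K ℚ.* r ≡ ι (+ m) → IsPackingRadius A r
  isPackingRadius {m} {r} connected ((S , ((v , Sv) , (w , Sw)) , μ₁S≡m) , m≤μ₁) Kr≡m =
    upper , lower
    where
    m≥1 : 1 ℕ.≤ m
    m≥1 = subst (1 ℕ.≤_) μ₁S≡m (μ₁-positive S (connected v w) Sv Sw)
    r>0 : 0ℚ ℚ.< r
    r>0 = ℚP.*-cancelˡ-<-nonNeg K {{ℚP.pos⇒nonNeg K}}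
      (subst₂ ℚ._<_ (sym (ℚP.*-zeroʳ K)) (sym Kr≡m)
        (ℚP.<-≤-trans (ℚP.positive⁻¹ 1ℚ) (ι-mono-≤ (ℤ.+≤+ m≥1))))
    upper : ∀ R → PairwiseDisjoint A R → R ℚ.≤ r
    upper R disjoint with R ℚP.≤? r
    ... | yes R≤r = R≤r
    ... | no R≰r = ⊥-elim (overlap-above S μ₁S≡m m≥1 (ℚP.<⇒≤ r>0) Kr≡m (ℚP.≰⇒> R≰r) disjoint)
    disjoint-below-r : ∀ {R} → 0ℚ ℚ.≤ R → R ℚ.< r → PairwiseDisjoint A R
    disjoint-below-r {R} R≥0 R<r =
      disjoint-below m≤μ₁ R≥0 (subst (K ℚ.* R ℚ.<_) Kr≡m (ℚP.*-monoʳ-<-pos K R<r))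
    lower : ∀ R → R ℚ.< r → ∃ λ R′ → PairwiseDisjoint A R′ × R ℚ.< R′
    lower R R<r with R ℚP.<? 0ℚ | ℚP.<-dense R<r
    ... | yes R<0 | _ = 0ℚ , disjoint-below-r ℚP.≤-refl r>0 , R<0
    ... | no R≮0 | R′ , R<R′ , R′<r =
      R′ , disjoint-below-r (ℚP.<⇒≤ (ℚP.≤-<-trans (ℚP.≮⇒≥ R≮0) R<R′)) R′<r , R<R′

mainTheorem5 : (n : ℕ) → n ≥ 1 → (A : Adj n) → Undirected A → Loopless A → Connected A →
    (m : ℕ) → IsMC₁ A m → IsPackingRadius A ((+ m) / (suc n))
mainTheorem5 n _ A A-sym _ connected m mc = isPackingRadius connected mc (K*[m/K]≡m m)
  where
  open Simplex n
  open Packing A A-sym
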